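{- Let $p$ be an odd prime, $n\ge1$, $G=D_{p^n}=\langle r,s\mid r^{p^n}=s^2=e,\ srs^{ -1}=r^{ -1}\rangle$, with rank function $P$ as in the context. For $0\le j<k\le n+1$ let $\alpha(j,k)$ be the number of $G$-conjugacy classes of pairs $(H,K)$ of subgroups with $H\subsetneq K$, $P(H)=j$ and $P(K)=k$ (where $G$ acts by $g\cdot(H,K)=(gHg^{ -1},gKg^{ -1})$). Then \[\alpha(j,k)=\begin{cases}1 & j=0,\ k=n+1,\\ 2 & j=0,\ 1\le k\le n,\\ 2 & 1\le j\le n,\ k=n+1,\\ 3 & 1\le j<k\le n.\end{cases}\]
   Context: For $0\le k\le n$, $C_{p^k}:=\langle r^{p^{n-k}}\rangle$ and $D_{p^k}:=\langle r^{p^{n-k}},s\rangle$. Every subgroup of $G$ is either some $C_{p^k}$ or a conjugate of some $D_{p^k}$. The rank function $P\colon\operatorname{Sub}(G)\to\{0,\dots,n+1\}$ is defined by $P(C_{p^k})=k$ and $P(H)=k+1$ for every conjugate $H$ of $D_{p^k}$. -}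

module Defs where

open import Data.Nat using (ℕ; zero; suc; _+_; _*_; _∸_; _^_; _≤_; _<_; NonZero)
open import Data.Nat.Properties using (m^n≢0)
open import Data.Nat.DivMod using (_mod_)
open import Data.Fin using (Fin; toℕ)
open import Data.Bool using (Bool; true; false; _xor_)
open import Data.Vec using (Vec; lookup; tabulate)
open import Data.List using (List; _∷_; [])
open import Data.List.Membership.Propositional using (_∈_)
open import Data.Product using (Σ; ∃; _×_; _,_)
open import Data.Sum using (_⊎_)
open import Relation.Binary.PropositionalEquality using (_≡_; _≢_)

-- The dihedral group D_{p^n} = ⟨ r , s | r^{p^n} = s^2 = e , s r s⁻¹ = r⁻¹ ⟩
-- of order 2 p^n.  The element (a , b) stands for r^a s^b  (a mod p^n, b ∈ {0,1}).
module Dihedral (p n : ℕ) .{{p≢0 : NonZero p}} where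

  m : ℕ
  m = p ^ n

  instance
    m≢0 : NonZero m
    m≢0 = m^n≢0 p n

  G : Set
  G = Fin m × Bool

  _+ₘ_ : Fin m → Fin m → Fin m
  a +ₘ c = (toℕ a + toℕ c) mod m

  -ₘ_ : Fin m → Fin m
  -ₘ a = (m ∸ toℕ a) mod m

  e : G
  e = (0 mod m , false)

  -- r^a s^b · r^c s^d = r^(a + (-1)^b c) s^(b+d)
  _·_ : G → G → G
  (a , false) · (c , d) = (a +ₘ c , d)
  (a , true)  · (c , d) = (a +ₘ (-ₘ c) , true xor d)

  _⁻¹ : G → G
  (a , false) ⁻¹ = (-ₘ a , false)
  (a , true)  ⁻¹ = (a , true)

  rpow : ℕ → G
  rpow a = (a mod m , false)

  s : G
  s = (0 mod m , true)

  -- A subset of G, given by its characteristic vectors on rotations r^a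
  -- and on reflections r^a s.  Equality of subsets is propositional equality.
  SubG : Set
  SubG = Vec Bool m × Vec Bool m

  _∈G_ : G → SubG → Set
  (a , false) ∈G (R , S) = lookup R a ≡ true
  (a , true)  ∈G (R , S) = lookup S a ≡ true

  _⊆G_ : SubG → SubG → Set
  H ⊆G K = ∀ x → x ∈G H → x ∈G K

  _⊊G_ : SubG → SubG → Set
  H ⊊G K = H ⊆G K × H ≢ K

  record IsSubgroup (H : SubG) : Set where
    field
      has-e   : e ∈G H
      has-·   : ∀ x y → x ∈G H → y ∈G H → (x · y) ∈G H
      has-⁻¹  : ∀ x → x ∈G H → (x ⁻¹) ∈G H

  record GeneratedBy (H : SubG) (gs : List G) : Set where
    field
      subgroup : IsSubgroup H
      contains : ∀ x → x ∈ gs → x ∈G H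
      least    : ∀ K → IsSubgroup K → (∀ x → x ∈ gs → x ∈G K) → H ⊆G K

  member : G → SubG → Bool
  member (a , false) (R , S) = lookup R a
  member (a , true)  (R , S) = lookup S a

  -- the conjugate g H g⁻¹ = { x | g⁻¹ x g ∈ H }
  conj : G → SubG → SubG
  conj g H = ( tabulate (λ a → member (((g ⁻¹) · (a , false)) · g) H)
             , tabulate (λ a → member (((g ⁻¹) · (a , true)) · g) H) )

  -- C_{p^k} = ⟨ r^{p^{n-k}} ⟩ ,  D_{p^k} = ⟨ r^{p^{n-k}} , s ⟩
  IsC : ℕ → SubG → Set
  IsC k H = GeneratedBy H (rpow (p ^ (n ∸ k)) ∷ [])

  IsD : ℕ → SubG → Set
  IsD k H = GeneratedBy H (rpow (p ^ (n ∸ k)) ∷ s ∷ [])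

  -- the rank function P : Sub(G) → {0,…,n+1}, as a relation "P(H) = j":
  -- P(C_{p^k}) = k, and P(H) = k+1 for every conjugate H of D_{p^k}  (0 ≤ k ≤ n).
  Rank : SubG → ℕ → Set
  Rank H j =
      (j ≤ n × IsC j H)
    ⊎ (Σ ℕ λ k → j ≡ suc k × k ≤ n × Σ G λ g → Σ SubG λ D → IsD k D × H ≡ conj g D)

  ValidPair : ℕ → ℕ → SubG × SubG → Set
  ValidPair j k (H , K) = IsSubgroup H × IsSubgroup K × H ⊊G K × Rank H j × Rank K k

  SameOrbit : SubG × SubG → SubG × SubG → Set
  SameOrbit (H , K) (H' , K') = Σ G λ g → conj g H ≡ H' × conj g K ≡ K'

  -- "α(j,k) = c": the valid pairs fall into exactly c G-conjugacy classes,
  -- witnessed by c pairwise non-conjugate valid representatives such that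
  -- every valid pair is conjugate to one of them.
  α≡ : ℕ → ℕ → ℕ → Set
  α≡ j k c =
    Σ (Vec (SubG × SubG) c) λ reps →
        (∀ i → ValidPair j k (lookup reps i))
      × (∀ i i' → SameOrbit (lookup reps i) (lookup reps i') → i ≡ i')
      × (∀ x → ValidPair j k x → ∃ λ i → SameOrbit x (lookup reps i))

-- Write d_k = p^(n-k).  A subgroup of rank j is either C_j = Cyc d_j = ⟨r^(d_j)⟩ or, when
-- j = k + 1, a conjugate of D_k, i.e. some Dih d_k t = ⟨r^(d_k), r^(-t) s⟩.  Since p is odd,
-- 2 is invertible modulo d_k: with 2h ≡ 1, conjugation by the rotation r^(h t) moves
-- Dih d_k t to Dih d_k 0.  If Dih a t ⊆ Dih b t′ then t ≡ t′ (mod b), so one rotation centres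
-- both members of a pair of dihedral subgroups.  A dihedral subgroup is never contained in a
-- cyclic one, so every pair H ⊊ K is conjugate to (C_j, C_k), (C_j, D_(k-1)) or
-- (D_(j-1), D_(k-1)); these are pairwise non-conjugate, since conjugation preserves being
-- cyclic.  Counting the shapes allowed by the ranks j < k gives 1, 2, 2 and 3.
module Submission where

open import Data.Bool using (Bool; true; false)
open import Data.Bool.Properties using (⇔→≡)
open import Data.Empty using (⊥-elim)
open import Data.Fin using (Fin; toℕ; zero; suc)
open import Data.Fin.Properties using (toℕ-fromℕ<; toℕ-injective; toℕ<n)
open import Data.List using ([]; _∷_)
open import Data.List.Membership.Propositional using (_∈_)
open import Data.List.Relation.Unary.Any using (here; there)
open import Data.Nat
  using (ℕ; zero; suc; _+_; _*_; _∸_; _^_; _≤_; _<_; NonZero; pred; z≤n; s≤s; nonTrivial⇒n>1)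
open import Data.Nat.DivMod using (_%_; _mod_; %-distribˡ-+; %-remove-+ʳ; m∣n⇒o%n%m≡o%m; m<n⇒m%n≡m)
open import Data.Nat.Divisibility
  using ( _∣_; _∣?_; divides; ∣-refl; ∣-trans; _∣0; ∣1⇒≡1; m∣m*n; ∣m+n∣m⇒∣n; ∣m∣n⇒∣m+n
        ; n∣m⇒m%n≡0; m%n≡0⇒n∣m; ∣n∣m%n⇒∣m; %-presˡ-∣; >⇒∤)
open import Data.Nat.Primality using (Prime; prime[2]; euclidsLemma; prime⇒nonZero; prime⇒nonTrivial)
open import Data.Nat.Properties
  using ( ≤-refl; ≤-trans; <⇒≤; n≮n; +-comm; +-suc; +-identityʳ; *-comm; *-distribʳ-+; suc-pred
        ; m∸n+n≡m; m+[n∸m]≡n; m∸n≤m; ∸-monoʳ-≤; ∸-monoʳ-<; m^n≢0; ^-monoʳ-<; ^-distribˡ-+-*)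
open import Data.Nat.Tactic.RingSolver using (solve-∀)
open import Data.Product using (∃; ∃₂; _×_; _,_; proj₁)
open import Data.Sum using (_⊎_; inj₁; inj₂)
open import Data.Vec using (Vec; lookup; tabulate; []; _∷_)
open import Data.Vec.Properties using (lookup∘tabulate; tabulate∘lookup; tabulate-cong)
open import Function.Bundles using (_⇔_; mk⇔; Equivalence)
open import Relation.Binary.PropositionalEquality
open import Relation.Nullary using (¬_; Dec; yes; does)
open import Relation.Nullary.Decidable using (dec-true; does-⇔)

open import Defs

-- Uses are written x ≡ y [mod d ]: without the space, d] would lex as a single name.
infix 4 _≡_[mod_]
_≡_[mod_] : ℕ → ℕ → (d : ℕ) .{{_ : NonZero d}} → Set
x ≡ y [mod d ] = x % d ≡ y % d

module _ {d : ℕ} .{{_ : NonZero d}} where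

  +-cong-mod : ∀ {x x′ y y′} → x ≡ x′ [mod d ] → y ≡ y′ [mod d ] → x + y ≡ x′ + y′ [mod d ]
  +-cong-mod {x} {x′} {y} {y′} x≡x′ y≡y′ = begin
    (x + y) % d            ≡⟨ %-distribˡ-+ x y d ⟩
    (x % d + y % d) % d    ≡⟨ cong₂ (λ u v → (u + v) % d) x≡x′ y≡y′ ⟩
    (x′ % d + y′ % d) % d  ≡⟨ %-distribˡ-+ x′ y′ d ⟨
    (x′ + y′) % d          ∎
    where open ≡-Reasoning

  ∣-resp-≡-mod : ∀ {x y} → x ≡ y [mod d ] → d ∣ x → d ∣ y
  ∣-resp-≡-mod {x} {y} x≡y d∣x = m%n≡0⇒n∣m y d (trans (sym x≡y) (n∣m⇒m%n≡0 x d d∣x))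

  ≡-mod⇒∣⇔ : ∀ {x y} → x ≡ y [mod d ] → (d ∣ x ⇔ d ∣ y)
  ≡-mod⇒∣⇔ x≡y = mk⇔ (∣-resp-≡-mod x≡y) (∣-resp-≡-mod (sym x≡y))

  ∣x+pred[d]*x : ∀ x → d ∣ x + pred d * x
  ∣x+pred[d]*x x = divides x (trans (cong (_* x) (suc-pred d)) (*-comm d x))

∣+⇒∣⇔ : ∀ {d x y} → d ∣ x + y → (d ∣ x ⇔ d ∣ y)
∣+⇒∣⇔ {d} {x} {y} d∣x+y =
  mk⇔ (∣m+n∣m⇒∣n d∣x+y) (∣m+n∣m⇒∣n (subst (d ∣_) (+-comm x y) d∣x+y))

∣+-transfer : ∀ {d t t′ u w} → d ∣ t + w → d ∣ t′ + w → d ∣ t + u → d ∣ t′ + u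
∣+-transfer {d} {t} {t′} {u} {w} d∣t+w d∣t′+w d∣t+u =
  ∣m+n∣m⇒∣n (subst (d ∣_) (regroup t u t′ w) (∣m∣n⇒∣m+n d∣t+u d∣t′+w)) d∣t+w
  where
  regroup : ∀ t u t′ w → (t + u) + (t′ + w) ≡ (t + w) + (t′ + u)
  regroup = solve-∀

odd⇒half : ∀ d → ¬ 2 ∣ d → ∃ λ h → h + h ≡ suc d
odd⇒half zero ¬2∣0 = ⊥-elim (¬2∣0 (divides 0 refl))
odd⇒half (suc zero) _ = 1 , refl
odd⇒half (suc (suc d)) ¬2∣d+2 with odd⇒half d (λ 2∣d → ¬2∣d+2 (∣m∣n⇒∣m+n ∣-refl 2∣d))
... | h , h+h≡d+1 = suc h , cong suc (trans (+-suc h h) (cong suc h+h≡d+1))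

odd^ : ∀ {p} → ¬ 2 ∣ p → ∀ e → ¬ 2 ∣ p ^ e
odd^ _ zero 2∣1 with () ← ∣1⇒≡1 2∣1
odd^ {p} ¬2∣p (suc e) 2∣p^[1+e] with euclidsLemma p (p ^ e) prime[2] 2∣p^[1+e]
... | inj₁ 2∣p   = ¬2∣p 2∣p
... | inj₂ 2∣p^e = odd^ ¬2∣p e 2∣p^e

^-monoʳ-∣ : ∀ p {a b} → a ≤ b → p ^ a ∣ p ^ b
^-monoʳ-∣ p {a} {b} a≤b = subst (p ^ a ∣_) p^a*p^[b∸a]≡p^b (m∣m*n (p ^ (b ∸ a)))
  where
  p^a*p^[b∸a]≡p^b : p ^ a * p ^ (b ∸ a) ≡ p ^ b
  p^a*p^[b∸a]≡p^b = trans (sym (^-distribˡ-+-* p a (b ∸ a))) (cong (p ^_) (m+[n∸m]≡n a≤b))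

lookup-ext : ∀ {A : Set} {k} {xs ys : Vec A k} → (∀ i → lookup xs i ≡ lookup ys i) → xs ≡ ys
lookup-ext {xs = xs} {ys} eq =
  trans (sym (tabulate∘lookup xs)) (trans (tabulate-cong eq) (tabulate∘lookup ys))

does-true⇒ : ∀ {A : Set} (a? : Dec A) → does a? ≡ true → A
does-true⇒ (yes a) _ = a

module DihedralSubgroups (p n : ℕ) .{{_ : NonZero p}} where
  open Dihedral p n

  toℕ-mod : ∀ x → toℕ (x mod m) ≡ x % m
  toℕ-mod x = toℕ-fromℕ< _

  mod-toℕ : ∀ a → toℕ a mod m ≡ a
  mod-toℕ a = toℕ-injective (trans (toℕ-mod (toℕ a)) (m<n⇒m%n≡m (toℕ<n a)))

  +ₘ-mod : ∀ x y → (x mod m) +ₘ (y mod m) ≡ (x + y) mod m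
  +ₘ-mod x y = toℕ-injective (begin
    toℕ ((x mod m) +ₘ (y mod m))         ≡⟨ toℕ-mod _ ⟩
    (toℕ (x mod m) + toℕ (y mod m)) % m  ≡⟨ cong₂ (λ u v → (u + v) % m) (toℕ-mod x) (toℕ-mod y) ⟩
    (x % m + y % m) % m                  ≡⟨ %-distribˡ-+ x y m ⟨
    (x + y) % m                          ≡⟨ toℕ-mod (x + y) ⟨
    toℕ ((x + y) mod m)                  ∎)
    where open ≡-Reasoning

  ∣-toℕ-mod⇔ : ∀ {d} → d ∣ m → ∀ x → d ∣ toℕ (x mod m) ⇔ d ∣ x
  ∣-toℕ-mod⇔ {d} d∣m x = mk⇔
    (λ d∣x%m → ∣n∣m%n⇒∣m d∣m (subst (d ∣_) (toℕ-mod x) d∣x%m))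
    (λ d∣x → subst (d ∣_) (sym (toℕ-mod x)) (%-presˡ-∣ d∣x d∣m))

  ⊆-antisym : ∀ {H K} → H ⊆G K → K ⊆G H → H ≡ K
  ⊆-antisym {R , S} {R′ , S′} H⊆K K⊆H = cong₂ _,_
    (lookup-ext λ a → ⇔→≡ (mk⇔ (H⊆K (a , false)) (K⊆H (a , false))))
    (lookup-ext λ a → ⇔→≡ (mk⇔ (H⊆K (a , true)) (K⊆H (a , true))))

  generated-unique : ∀ {H K gs} → GeneratedBy H gs → GeneratedBy K gs → H ≡ K
  generated-unique H-gen K-gen = ⊆-antisym
    (GeneratedBy.least H-gen _ (GeneratedBy.subgroup K-gen) (GeneratedBy.contains K-gen))
    (GeneratedBy.least K-gen _ (GeneratedBy.subgroup H-gen) (GeneratedBy.contains H-gen))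

  rpow-multiple∈ : ∀ {K d} → IsSubgroup K → rpow d ∈G K → ∀ q → rpow (q * d) ∈G K
  rpow-multiple∈ K≤G r^d∈K zero = IsSubgroup.has-e K≤G
  rpow-multiple∈ {K} {d} K≤G r^d∈K (suc q) =
    subst (_∈G K) r^qd·r^d≡r^[1+q]d
      (IsSubgroup.has-· K≤G (rpow (q * d)) (rpow d) (rpow-multiple∈ K≤G r^d∈K q) r^d∈K)
    where
    r^qd·r^d≡r^[1+q]d : rpow (q * d) · rpow d ≡ rpow (suc q * d)
    r^qd·r^d≡r^[1+q]d = cong (_, false) (trans (+ₘ-mod (q * d) d) (cong (_mod m) (+-comm (q * d) d)))

  rotation∈ : ∀ {K d a} → IsSubgroup K → rpow d ∈G K → d ∣ toℕ a → (a , false) ∈G K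
  rotation∈ {K} {d} {a} K≤G r^d∈K (divides q a≡q*d) =
    subst (_∈G K) (cong (_, false) (trans (cong (_mod m) (sym a≡q*d)) (mod-toℕ a)))
      (rpow-multiple∈ K≤G r^d∈K q)

  +ₘ-identityʳ : ∀ a → a +ₘ (0 mod m) ≡ a
  +ₘ-identityʳ a = begin
    a +ₘ (0 mod m)               ≡⟨ cong (_+ₘ (0 mod m)) (mod-toℕ a) ⟨
    (toℕ a mod m) +ₘ (0 mod m)   ≡⟨ +ₘ-mod (toℕ a) 0 ⟩
    (toℕ a + 0) mod m            ≡⟨ cong (_mod m) (+-identityʳ (toℕ a)) ⟩
    toℕ a mod m                  ≡⟨ mod-toℕ a ⟩
    a                            ∎
    where open ≡-Reasoning

  divisibleBy : ℕ → (Fin m → ℕ) → Vec Bool m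
  divisibleBy d f = tabulate (λ a → does (d ∣? f a))

  no-reflections : Vec Bool m
  no-reflections = tabulate (λ _ → false)

  multiples : ℕ → Vec Bool m
  multiples d = divisibleBy d toℕ

  -- Cyc d = ⟨r^d⟩ and Dih d t = ⟨r^d, r^(-t) s⟩, as characteristic vectors.
  Cyc : ℕ → SubG
  Cyc d = (multiples d , no-reflections)

  Dih : ℕ → ℕ → SubG
  Dih d t = (multiples d , divisibleBy d (λ a → t + toℕ a))

  ∈divisibleBy⇒∣ : ∀ {d f} a → lookup (divisibleBy d f) a ≡ true → d ∣ f a
  ∈divisibleBy⇒∣ {d} {f} a a∈ = does-true⇒ (d ∣? f a) (trans (sym (lookup∘tabulate _ a)) a∈)

  ∣⇒∈divisibleBy : ∀ {d f} a → d ∣ f a → lookup (divisibleBy d f) a ≡ true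
  ∣⇒∈divisibleBy {d} {f} a d∣fa = trans (lookup∘tabulate _ a) (dec-true (d ∣? f a) d∣fa)

  divisibleBy-cong : ∀ {d f g} → (∀ a → d ∣ f a ⇔ d ∣ g a) → divisibleBy d f ≡ divisibleBy d g
  divisibleBy-cong {d} {f} {g} f⇔g = tabulate-cong λ a → does-⇔ (f⇔g a) (d ∣? f a) (d ∣? g a)

  divisibleBy-reindex : ∀ {d f g} (σ : Fin m → Fin m) → (∀ a → d ∣ f (σ a) ⇔ d ∣ g a) →
                        tabulate (λ a → lookup (divisibleBy d f) (σ a)) ≡ divisibleBy d g
  divisibleBy-reindex σ f∘σ⇔g =
    trans (tabulate-cong λ a → lookup∘tabulate _ (σ a)) (divisibleBy-cong f∘σ⇔g)

  no-reflections-reindex : ∀ (σ : Fin m → Fin m) →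
                           tabulate (λ a → lookup no-reflections (σ a)) ≡ no-reflections
  no-reflections-reindex σ = tabulate-cong λ a → lookup∘tabulate _ (σ a)

  centre : ℕ → ℕ → Fin m
  centre h t = (h * t) mod m

  Cyc-reflection-free : ∀ {d} a → ¬ (a , true) ∈G Cyc d
  Cyc-reflection-free a a∈ with () ← trans (sym (lookup∘tabulate (λ _ → false) a)) a∈

  module Divisor {d : ℕ} .{{_ : NonZero d}} (d∣m : d ∣ m) where

    ∈multiples⇒∣ : ∀ a → lookup (multiples d) a ≡ true → d ∣ toℕ a
    ∈multiples⇒∣ = ∈divisibleBy⇒∣ {d} {toℕ}

    ∣⇒∈multiples : ∀ a → d ∣ toℕ a → lookup (multiples d) a ≡ true
    ∣⇒∈multiples = ∣⇒∈divisibleBy {d} {toℕ}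

    toℕ-mod≡ : ∀ x → toℕ (x mod m) ≡ x [mod d ]
    toℕ-mod≡ x = trans (cong (_% d) (toℕ-mod x)) (m∣n⇒o%n%m≡o%m d m x d∣m)

    toℕ-+ₘ-+ₘ : ∀ a b c → toℕ ((a +ₘ b) +ₘ c) ≡ toℕ a + toℕ b + toℕ c [mod d ]
    toℕ-+ₘ-+ₘ a b c = trans (toℕ-mod≡ (toℕ (a +ₘ b) + toℕ c)) (+-cong-mod (toℕ-mod≡ (toℕ a + toℕ b)) refl)

    ∣-toℕ-+ₘ : ∀ {a c} → d ∣ toℕ a → d ∣ toℕ c → d ∣ toℕ (a +ₘ c)
    ∣-toℕ-+ₘ {a} {c} d∣a d∣c = Equivalence.from (∣-toℕ-mod⇔ d∣m (toℕ a + toℕ c)) (∣m∣n⇒∣m+n d∣a d∣c)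

    ∣-toℕ-ₘ+ : ∀ a → d ∣ toℕ (-ₘ a) + toℕ a
    ∣-toℕ-ₘ+ a = ∣-resp-≡-mod (+-cong-mod (sym (toℕ-mod≡ (m ∸ toℕ a))) refl)
                   (subst (d ∣_) (sym (m∸n+n≡m (<⇒≤ (toℕ<n a)))) d∣m)

    ∣-toℕ-ₘ : ∀ {a} → d ∣ toℕ a → d ∣ toℕ (-ₘ a)
    ∣-toℕ-ₘ {a} = Equivalence.from (∣+⇒∣⇔ (∣-toℕ-ₘ+ a))

    -- Modulo d, the index of g⁻¹ · y · g for g ∈ {r^x, r^x s} and y ∈ {r^a, r^a s},
    -- written exactly as _·_ and _⁻¹ compute it.
    rotation-conj-rotation : ∀ x a → toℕ (((-ₘ x) +ₘ a) +ₘ x) ≡ toℕ a [mod d ]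
    rotation-conj-rotation x a = begin
      toℕ (((-ₘ x) +ₘ a) +ₘ x) % d  ≡⟨ toℕ-+ₘ-+ₘ (-ₘ x) a x ⟩
      (x̄ + toℕ a + toℕ x) % d       ≡⟨ cong (_% d) (regroup x̄ (toℕ a) (toℕ x)) ⟩
      (toℕ a + (x̄ + toℕ x)) % d     ≡⟨ %-remove-+ʳ (toℕ a) (∣-toℕ-ₘ+ x) ⟩
      toℕ a % d                     ∎
      where
      open ≡-Reasoning
      x̄ : ℕ
      x̄ = toℕ (-ₘ x)
      regroup : ∀ x̄ a x → x̄ + a + x ≡ a + (x̄ + x)
      regroup = solve-∀

    reflection-conj-rotation : ∀ x a → d ∣ toℕ ((x +ₘ (-ₘ a)) +ₘ (-ₘ x)) + toℕ a
    reflection-conj-rotation x a =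
      ∣-resp-≡-mod congruence (∣m∣n⇒∣m+n (∣-toℕ-ₘ+ a) (∣-toℕ-ₘ+ x))
      where
      open ≡-Reasoning
      ā x̄ : ℕ
      ā = toℕ (-ₘ a)
      x̄ = toℕ (-ₘ x)
      regroup : ∀ ā a x̄ x → (ā + a) + (x̄ + x) ≡ x + ā + x̄ + a
      regroup = solve-∀
      congruence : (ā + toℕ a) + (x̄ + toℕ x) ≡ toℕ ((x +ₘ (-ₘ a)) +ₘ (-ₘ x)) + toℕ a [mod d ]
      congruence = begin
        ((ā + toℕ a) + (x̄ + toℕ x)) % d            ≡⟨ cong (_% d) (regroup ā (toℕ a) x̄ (toℕ x)) ⟩
        (toℕ x + ā + x̄ + toℕ a) % d                ≡⟨ +-cong-mod (toℕ-+ₘ-+ₘ x (-ₘ a) (-ₘ x)) refl ⟨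
        (toℕ ((x +ₘ (-ₘ a)) +ₘ (-ₘ x)) + toℕ a) % d  ∎

    rotation-conj-reflection : ∀ x a t →
      t + toℕ (((-ₘ x) +ₘ a) +ₘ (-ₘ x)) ≡ (t + (toℕ (-ₘ x) + toℕ (-ₘ x))) + toℕ a [mod d ]
    rotation-conj-reflection x a t = begin
      (t + toℕ (((-ₘ x) +ₘ a) +ₘ (-ₘ x))) % d  ≡⟨ +-cong-mod {x = t} refl (toℕ-+ₘ-+ₘ (-ₘ x) a (-ₘ x)) ⟩
      (t + (x̄ + toℕ a + x̄)) % d               ≡⟨ cong (_% d) (regroup t x̄ (toℕ a)) ⟩
      ((t + (x̄ + x̄)) + toℕ a) % d             ∎
      where
      open ≡-Reasoning
      x̄ : ℕ
      x̄ = toℕ (-ₘ x)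
      regroup : ∀ t x̄ a → t + (x̄ + a + x̄) ≡ (t + (x̄ + x̄)) + a
      regroup = solve-∀

    reflection-conj-reflection : ∀ x a t →
      d ∣ (t + toℕ ((x +ₘ (-ₘ a)) +ₘ x)) + (pred d * (t + toℕ x + toℕ x) + toℕ a)
    reflection-conj-reflection x a t =
      ∣-resp-≡-mod congruence (∣m∣n⇒∣m+n (∣x+pred[d]*x u) (∣-toℕ-ₘ+ a))
      where
      open ≡-Reasoning
      u ā c : ℕ
      u = t + toℕ x + toℕ x
      ā = toℕ (-ₘ a)
      c = pred d * u
      regroup : ∀ t x ā a c → (t + x + x) + c + (ā + a) ≡ t + (x + ā + x) + (c + a)
      regroup = solve-∀
      congruence : (u + c) + (ā + toℕ a) ≡ (t + toℕ ((x +ₘ (-ₘ a)) +ₘ x)) + (c + toℕ a) [mod d ]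
      congruence = begin
        ((u + c) + (ā + toℕ a)) % d                    ≡⟨ cong (_% d) (regroup t (toℕ x) ā (toℕ a) c) ⟩
        (t + (toℕ x + ā + toℕ x) + (c + toℕ a)) % d    ≡⟨ +-cong-mod (+-cong-mod {x = t} refl
                                                            (toℕ-+ₘ-+ₘ x (-ₘ a) x)) refl ⟨
        (t + toℕ ((x +ₘ (-ₘ a)) +ₘ x) + (c + toℕ a)) % d  ∎

    conj-Cyc : ∀ g → conj g (Cyc d) ≡ Cyc d
    conj-Cyc (x , false) = cong₂ _,_
      (divisibleBy-reindex _ λ a → ≡-mod⇒∣⇔ (rotation-conj-rotation x a))
      (no-reflections-reindex _)
    conj-Cyc (x , true) = cong₂ _,_
      (divisibleBy-reindex _ λ a → ∣+⇒∣⇔ (reflection-conj-rotation x a))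
      (no-reflections-reindex _)

    conj-rotation-Dih : ∀ x t → conj (x , false) (Dih d t) ≡ Dih d (t + (toℕ (-ₘ x) + toℕ (-ₘ x)))
    conj-rotation-Dih x t = cong₂ _,_
      (divisibleBy-reindex _ λ a → ≡-mod⇒∣⇔ (rotation-conj-rotation x a))
      (divisibleBy-reindex _ λ a → ≡-mod⇒∣⇔ (rotation-conj-reflection x a t))

    conj-reflection-Dih : ∀ x t → conj (x , true) (Dih d t) ≡ Dih d (pred d * (t + toℕ x + toℕ x))
    conj-reflection-Dih x t = cong₂ _,_
      (divisibleBy-reindex _ λ a → ∣+⇒∣⇔ (reflection-conj-rotation x a))
      (divisibleBy-reindex _ λ a → ∣+⇒∣⇔ (reflection-conj-reflection x a t))

    conj-Dih : ∀ g t → ∃ λ t′ → conj g (Dih d t) ≡ Dih d t′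
    conj-Dih (x , false) t = _ , conj-rotation-Dih x t
    conj-Dih (x , true)  t = _ , conj-reflection-Dih x t

    ∣-shift-by-centre : ∀ h → h + h ≡ suc d → ∀ t → d ∣ t + (toℕ (-ₘ centre h t) + toℕ (-ₘ centre h t))
    ∣-shift-by-centre h h+h≡1+d t = ∣-resp-≡-mod (begin
      ((x̄ + x) + (x̄ + x)) % d  ≡⟨ cong (_% d) (regroup x̄ x) ⟩
      ((x + x) + (x̄ + x̄)) % d  ≡⟨ +-cong-mod t≡x+x refl ⟨
      (t + (x̄ + x̄)) % d        ∎)
      (∣m∣n⇒∣m+n (∣-toℕ-ₘ+ _) (∣-toℕ-ₘ+ _))
      where
      open ≡-Reasoning
      x x̄ : ℕ
      x = toℕ (centre h t)
      x̄ = toℕ (-ₘ centre h t)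
      regroup : ∀ x̄ x → (x̄ + x) + (x̄ + x) ≡ (x + x) + (x̄ + x̄)
      regroup = solve-∀
      t≡x+x : t ≡ x + x [mod d ]
      t≡x+x = begin
        t % d                ≡⟨ %-remove-+ʳ t (m∣m*n {d} t) ⟨
        (t + d * t) % d      ≡⟨ cong (λ k → (k * t) % d) h+h≡1+d ⟨
        ((h + h) * t) % d    ≡⟨ cong (_% d) (*-distribʳ-+ t h h) ⟩
        (h * t + h * t) % d  ≡⟨ +-cong-mod (toℕ-mod≡ (h * t)) (toℕ-mod≡ (h * t)) ⟨
        (x + x) % d          ∎

    Dih-centred : ∀ {t} → d ∣ t → Dih d t ≡ Dih d 0
    Dih-centred d∣t = cong (multiples d ,_) (divisibleBy-cong λ a →
      mk⇔ (λ d∣t+a → ∣m+n∣m⇒∣n d∣t+a d∣t) (∣m∣n⇒∣m+n d∣t))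

    conj-centre-Dih : ∀ h → h + h ≡ suc d → ∀ t → conj (centre h t , false) (Dih d t) ≡ Dih d 0
    conj-centre-Dih h h+h≡1+d t =
      trans (conj-rotation-Dih (centre h t) t) (Dih-centred (∣-shift-by-centre h h+h≡1+d t))

    conj-e-Dih : conj e (Dih d 0) ≡ Dih d 0
    conj-e-Dih = trans (conj-rotation-Dih (0 mod m) 0) (Dih-centred (∣m∣n⇒∣m+n d∣0̄ d∣0̄))
      where
      d∣0̄ : d ∣ toℕ (-ₘ (0 mod m))
      d∣0̄ = ∣-toℕ-ₘ (Equivalence.from (∣-toℕ-mod⇔ d∣m 0) (d ∣0))

    d∈multiples : lookup (multiples d) (d mod m) ≡ true
    d∈multiples = ∣⇒∈multiples _ (Equivalence.from (∣-toℕ-mod⇔ d∣m d) ∣-refl)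

    0∈multiples : lookup (multiples d) (0 mod m) ≡ true
    0∈multiples = ∣⇒∈multiples _ (Equivalence.from (∣-toℕ-mod⇔ d∣m 0) (d ∣0))

    Cyc-subgroup : IsSubgroup (Cyc d)
    Cyc-subgroup = record { has-e = 0∈multiples ; has-· = ·-closed ; has-⁻¹ = ⁻¹-closed }
      where
      ·-closed : ∀ x y → x ∈G Cyc d → y ∈G Cyc d → (x · y) ∈G Cyc d
      ·-closed (a , false) (c , false) a∈ c∈ =
        ∣⇒∈multiples _ (∣-toℕ-+ₘ (∈multiples⇒∣ a a∈) (∈multiples⇒∣ c c∈))
      ·-closed (a , false) (c , true) _ c∈ = ⊥-elim (Cyc-reflection-free {d} c c∈)
      ·-closed (a , true) _ a∈ _ = ⊥-elim (Cyc-reflection-free {d} a a∈)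
      ⁻¹-closed : ∀ x → x ∈G Cyc d → (x ⁻¹) ∈G Cyc d
      ⁻¹-closed (a , false) a∈ = ∣⇒∈multiples _ (∣-toℕ-ₘ (∈multiples⇒∣ a a∈))
      ⁻¹-closed (a , true) a∈ = ⊥-elim (Cyc-reflection-free {d} a a∈)

    -- Dih d 0 = { r^a s^b | d ∣ a }: its reflection part 0 + toℕ a reduces to toℕ a.
    Dih-subgroup : IsSubgroup (Dih d 0)
    Dih-subgroup = record { has-e = 0∈multiples ; has-· = ·-closed ; has-⁻¹ = ⁻¹-closed }
      where
      ·-closed : ∀ x y → x ∈G Dih d 0 → y ∈G Dih d 0 → (x · y) ∈G Dih d 0
      ·-closed (a , false) (c , false) a∈ c∈ =
        ∣⇒∈multiples _ (∣-toℕ-+ₘ (∈multiples⇒∣ a a∈) (∈multiples⇒∣ c c∈))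
      ·-closed (a , false) (c , true) a∈ c∈ =
        ∣⇒∈multiples _ (∣-toℕ-+ₘ (∈multiples⇒∣ a a∈) (∈multiples⇒∣ c c∈))
      ·-closed (a , true) (c , false) a∈ c∈ =
        ∣⇒∈multiples _ (∣-toℕ-+ₘ (∈multiples⇒∣ a a∈) (∣-toℕ-ₘ (∈multiples⇒∣ c c∈)))
      ·-closed (a , true) (c , true) a∈ c∈ =
        ∣⇒∈multiples _ (∣-toℕ-+ₘ (∈multiples⇒∣ a a∈) (∣-toℕ-ₘ (∈multiples⇒∣ c c∈)))
      ⁻¹-closed : ∀ x → x ∈G Dih d 0 → (x ⁻¹) ∈G Dih d 0
      ⁻¹-closed (a , false) a∈ = ∣⇒∈multiples _ (∣-toℕ-ₘ (∈multiples⇒∣ a a∈))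
      ⁻¹-closed (a , true) a∈ = a∈

    Cyc-generated : GeneratedBy (Cyc d) (rpow d ∷ [])
    Cyc-generated = record { subgroup = Cyc-subgroup ; contains = contains ; least = least }
      where
      contains : ∀ x → x ∈ rpow d ∷ [] → x ∈G Cyc d
      contains _ (here refl) = d∈multiples
      least : ∀ K → IsSubgroup K → (∀ x → x ∈ rpow d ∷ [] → x ∈G K) → Cyc d ⊆G K
      least K K≤G gens∈K (a , false) a∈ = rotation∈ K≤G (gens∈K _ (here refl)) (∈multiples⇒∣ a a∈)
      least K K≤G gens∈K (a , true)  a∈ = ⊥-elim (Cyc-reflection-free {d} a a∈)

    Dih-generated : GeneratedBy (Dih d 0) (rpow d ∷ s ∷ [])
    Dih-generated = record { subgroup = Dih-subgroup ; contains = contains ; least = least }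
      where
      contains : ∀ x → x ∈ rpow d ∷ s ∷ [] → x ∈G Dih d 0
      contains _ (here refl)         = d∈multiples
      contains _ (there (here refl)) = 0∈multiples
      least : ∀ K → IsSubgroup K → (∀ x → x ∈ rpow d ∷ s ∷ [] → x ∈G K) → Dih d 0 ⊆G K
      least K K≤G gens∈K (a , false) a∈ = rotation∈ K≤G (gens∈K _ (here refl)) (∈multiples⇒∣ a a∈)
      least K K≤G gens∈K (a , true)  a∈ =
        subst (_∈G K) (cong (_, true) (+ₘ-identityʳ a))
          (IsSubgroup.has-· K≤G (a , false) s
            (rotation∈ K≤G (gens∈K _ (here refl)) (∈multiples⇒∣ a a∈)) (gens∈K _ (there (here refl))))

    Dih-reflection : ∀ t → ((pred d * t) mod m , true) ∈G Dih d t
    Dih-reflection t = ∣⇒∈divisibleBy {d} _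
      (∣-resp-≡-mod (+-cong-mod {x = t} refl (sym (toℕ-mod≡ (pred d * t)))) (∣x+pred[d]*x t))

    Cyc≢Dih : ∀ {d′} t → Cyc d′ ≢ Dih d t
    Cyc≢Dih {d′} t Cyc≡Dih =
      Cyc-reflection-free {d′} _ (subst (((pred d * t) mod m , true) ∈G_) (sym Cyc≡Dih) (Dih-reflection t))

    Dih⊈Cyc : ∀ {d′} t → ¬ Dih d t ⊆G Cyc d′
    Dih⊈Cyc {d′} t Dih⊆Cyc =
      Cyc-reflection-free {d′} _ (Dih⊆Cyc ((pred d * t) mod m , true) (Dih-reflection t))

  open Divisor

  module DivisorPair {a b : ℕ} .{{_ : NonZero a}} .{{_ : NonZero b}} (a∣m : a ∣ m) (b∣m : b ∣ m) where

    multiples-⊆ : b ∣ a → ∀ c → lookup (multiples a) c ≡ true → lookup (multiples b) c ≡ true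
    multiples-⊆ b∣a c c∈ = ∣⇒∈multiples b∣m c (∣-trans b∣a (∈multiples⇒∣ a∣m c c∈))

    multiples-⊆⇒∣ : (∀ c → lookup (multiples a) c ≡ true → lookup (multiples b) c ≡ true) → b ∣ a
    multiples-⊆⇒∣ a⊆b = Equivalence.to (∣-toℕ-mod⇔ b∣m a) (∈multiples⇒∣ b∣m _ (a⊆b _ (d∈multiples a∣m)))

    Cyc⊆Cyc : b ∣ a → Cyc a ⊆G Cyc b
    Cyc⊆Cyc b∣a (c , false) = multiples-⊆ b∣a c
    Cyc⊆Cyc b∣a (c , true) c∈ = ⊥-elim (Cyc-reflection-free {a} c c∈)

    Cyc⊆Dih : b ∣ a → Cyc a ⊆G Dih b 0
    Cyc⊆Dih b∣a (c , false) = multiples-⊆ b∣a c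
    Cyc⊆Dih b∣a (c , true) c∈ = ⊥-elim (Cyc-reflection-free {a} c c∈)

    Dih⊆Dih : b ∣ a → Dih a 0 ⊆G Dih b 0
    Dih⊆Dih b∣a (c , false) = multiples-⊆ b∣a c
    Dih⊆Dih b∣a (c , true)  = multiples-⊆ b∣a c

    Cyc-Dih-orbit : ¬ 2 ∣ b → ∀ t → SameOrbit (Cyc a , Dih b t) (Cyc a , Dih b 0)
    Cyc-Dih-orbit ¬2∣b t with odd⇒half b ¬2∣b
    ... | h , h+h≡1+b =
      (centre h t , false) , conj-Cyc a∣m (centre h t , false) , conj-centre-Dih b∣m h h+h≡1+b t

    -- The rotation centring Dih a t also centres Dih b t′, because the reflection
    -- r^w s ∈ Dih a t ⊆ Dih b t′ forces t ≡ t′ (mod b).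
    Dih-Dih-orbit : ∀ {t t′} → ¬ 2 ∣ a → Dih a t ⊆G Dih b t′ →
                    SameOrbit (Dih a t , Dih b t′) (Dih a 0 , Dih b 0)
    Dih-Dih-orbit {t} {t′} ¬2∣a a⊆b with odd⇒half a ¬2∣a
    ... | h , h+h≡1+a =
      (x , false) , conj-centre-Dih a∣m h h+h≡1+a t ,
      trans (conj-rotation-Dih b∣m x t′) (Dih-centred b∣m b∣t′+x̄+x̄)
      where
      x w : Fin m
      x = centre h t
      w = (pred a * t) mod m
      b∣a : b ∣ a
      b∣a = multiples-⊆⇒∣ (λ c → a⊆b (c , false))
      b∣t+w : b ∣ t + toℕ w
      b∣t+w = ∣-trans b∣a (∈divisibleBy⇒∣ {a} {λ c → t + toℕ c} w (Dih-reflection a∣m t))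
      b∣t′+w : b ∣ t′ + toℕ w
      b∣t′+w = ∈divisibleBy⇒∣ {b} {λ c → t′ + toℕ c} w (a⊆b (w , true) (Dih-reflection a∣m t))
      b∣t′+x̄+x̄ : b ∣ t′ + (toℕ (-ₘ x) + toℕ (-ₘ x))
      b∣t′+x̄+x̄ = ∣+-transfer {t = t} {t′} {toℕ (-ₘ x) + toℕ (-ₘ x)} {toℕ w} b∣t+w b∣t′+w
                    (∣-trans b∣a (∣-shift-by-centre a∣m h h+h≡1+a t))

module PairClassification (p n : ℕ) .{{_ : NonZero p}} (1<p : 1 < p) (¬2∣p : ¬ 2 ∣ p) where
  open Dihedral p n
  open DihedralSubgroups p n

  level : ℕ → ℕ
  level k = p ^ (n ∸ k)

  level≢0 : ∀ k → NonZero (level k)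
  level≢0 k = m^n≢0 p (n ∸ k)

  level∣m : ∀ k → level k ∣ m
  level∣m k = ^-monoʳ-∣ p (m∸n≤m n k)

  level-∣ : ∀ {j k} → j ≤ k → level k ∣ level j
  level-∣ j≤k = ^-monoʳ-∣ p (∸-monoʳ-≤ n j≤k)

  level-< : ∀ {j k} → j < k → k ≤ n → level k < level j
  level-< j<k k≤n = ^-monoʳ-< p 1<p (∸-monoʳ-< j<k k≤n)

  level-odd : ∀ k → ¬ 2 ∣ level k
  level-odd k = odd^ ¬2∣p (n ∸ k)

  module AtLevel (k : ℕ) = Divisor {level k} {{level≢0 k}} (level∣m k)
  module AtLevels (j k : ℕ) = DivisorPair {level j} {level k} {{level≢0 j}} {{level≢0 k}} (level∣m j) (level∣m k)
  open AtLevel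
  open AtLevels

  C D : ℕ → SubG
  C k = Cyc (level k)
  D k = Dih (level k) 0

  levels-distinct : ∀ {j k S S′} → j < k → k ≤ n → (multiples (level j) , S) ≢ (multiples (level k) , S′)
  levels-distinct {j} {k} j<k k≤n j≡k = >⇒∤ {{level≢0 k}} (level-< j<k k≤n) (multiples-⊆⇒∣ k j k⊆j)
    where
    k⊆j : ∀ c → lookup (multiples (level k)) c ≡ true → lookup (multiples (level j)) c ≡ true
    k⊆j c = subst (λ R → lookup R c ≡ true) (cong (proj₁ {B = λ _ → Vec Bool m}) (sym j≡k))

  rank-C : ∀ {j} → j ≤ n → Rank (C j) j
  rank-C {j} j≤n = inj₁ (j≤n , Cyc-generated j)

  rank-D : ∀ {k} → k ≤ n → Rank (D k) (suc k)
  rank-D {k} k≤n = inj₂ (k , refl , k≤n , e , D k , Dih-generated k , sym (conj-e-Dih k))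

  rank-shape : ∀ {H j} → Rank H j →
               (j ≤ n × H ≡ C j) ⊎ (∃₂ λ k t → j ≡ suc k × H ≡ Dih (level k) t)
  rank-shape {j = j} (inj₁ (j≤n , H-gen)) = inj₁ (j≤n , generated-unique H-gen (Cyc-generated j))
  rank-shape (inj₂ (k , j≡1+k , _ , g , D′ , D′-gen , H≡gD′)) with conj-Dih k g 0
  ... | t , gD≡Dih = inj₂ (k , t , j≡1+k ,
          trans H≡gD′ (trans (cong (conj g) (generated-unique D′-gen (Dih-generated k))) gD≡Dih))

  CC-valid : ∀ {j k} → j < k → k ≤ n → ValidPair j k (C j , C k)
  CC-valid {j} {k} j<k k≤n =
    Cyc-subgroup j , Cyc-subgroup k ,
    (Cyc⊆Cyc j k (level-∣ (<⇒≤ j<k)) , levels-distinct j<k k≤n) ,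
    rank-C (≤-trans (<⇒≤ j<k) k≤n) , rank-C k≤n

  CD-valid : ∀ {j k} → j ≤ k → k ≤ n → ValidPair j (suc k) (C j , D k)
  CD-valid {j} {k} j≤k k≤n =
    Cyc-subgroup j , Dih-subgroup k ,
    (Cyc⊆Dih j k (level-∣ j≤k) , Cyc≢Dih k {level j} 0) ,
    rank-C (≤-trans j≤k k≤n) , rank-D k≤n

  DD-valid : ∀ {j k} → j < k → k ≤ n → ValidPair (suc j) (suc k) (D j , D k)
  DD-valid {j} {k} j<k k≤n =
    Dih-subgroup j , Dih-subgroup k ,
    (Dih⊆Dih j k (level-∣ (<⇒≤ j<k)) , levels-distinct j<k k≤n) ,
    rank-D (≤-trans (<⇒≤ j<k) k≤n) , rank-D k≤n

  classify : ∀ {j k x} → ValidPair j k x →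
      (k ≤ n × SameOrbit x (C j , C k))
    ⊎ (∃ λ k′ → k ≡ suc k′ × SameOrbit x (C j , D k′))
    ⊎ (∃₂ λ j′ k′ → j ≡ suc j′ × k ≡ suc k′ × SameOrbit x (D j′ , D k′))
  classify {j} {k} (_ , _ , (H⊆K , _) , rank-H , rank-K) with rank-shape rank-H | rank-shape rank-K
  ... | inj₁ (_ , refl) | inj₁ (k≤n , refl) =
    inj₁ (k≤n , e , conj-Cyc j e , conj-Cyc k e)
  ... | inj₁ (_ , refl) | inj₂ (k′ , t , refl , refl) =
    inj₂ (inj₁ (k′ , refl , Cyc-Dih-orbit j k′ (level-odd k′) t))
  ... | inj₂ (j′ , t , _ , refl) | inj₁ (_ , refl) = ⊥-elim (Dih⊈Cyc j′ {level k} t H⊆K)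
  ... | inj₂ (j′ , t , refl , refl) | inj₂ (k′ , t′ , refl , refl) =
    inj₂ (inj₂ (j′ , k′ , refl , refl , Dih-Dih-orbit j′ k′ (level-odd j′) H⊆K))

  conj-C≢D : ∀ j k g → conj g (C j) ≢ D k
  conj-C≢D j k g gC≡D = Cyc≢Dih k {level j} 0 (trans (sym (conj-Cyc j g)) gC≡D)

  conj-D≢C : ∀ j k g → conj g (D j) ≢ C k
  conj-D≢C j k g gD≡C with conj-Dih j g 0
  ... | t , gD≡Dih = Cyc≢Dih j {level k} t (trans (sym gD≡C) gD≡Dih)

  α[0,n+1]≡1 : α≡ 0 (suc n) 1
  α[0,n+1]≡1 = reps , (λ { zero → CD-valid z≤n ≤-refl }) , (λ { zero zero _ → refl }) , cover
    where
    reps : Vec (SubG × SubG) 1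
    reps = (C 0 , D n) ∷ []
    cover : ∀ x → ValidPair 0 (suc n) x → ∃ λ i → SameOrbit x (lookup reps i)
    cover x v with classify v
    ... | inj₁ (n+1≤n , _)              = ⊥-elim (n≮n n n+1≤n)
    ... | inj₂ (inj₁ (_ , refl , x∼CD)) = zero , x∼CD
    ... | inj₂ (inj₂ (_ , _ , () , _))

  α[0,k]≡2 : ∀ k → 1 ≤ k → k ≤ n → α≡ 0 k 2
  α[0,k]≡2 (suc k) _ k<n = reps , valid , distinct , cover
    where
    reps : Vec (SubG × SubG) 2
    reps = (C 0 , C (suc k)) ∷ (C 0 , D k) ∷ []
    valid : ∀ i → ValidPair 0 (suc k) (lookup reps i)
    valid zero       = CC-valid (s≤s z≤n) k<n
    valid (suc zero) = CD-valid z≤n (<⇒≤ k<n)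
    distinct : ∀ i i′ → SameOrbit (lookup reps i) (lookup reps i′) → i ≡ i′
    distinct zero       zero       _              = refl
    distinct zero       (suc zero) (g , _ , gC≡D) = ⊥-elim (conj-C≢D (suc k) k g gC≡D)
    distinct (suc zero) zero       (g , _ , gD≡C) = ⊥-elim (conj-D≢C k (suc k) g gD≡C)
    distinct (suc zero) (suc zero) _              = refl
    cover : ∀ x → ValidPair 0 (suc k) x → ∃ λ i → SameOrbit x (lookup reps i)
    cover x v with classify v
    ... | inj₁ (_ , x∼CC)               = zero , x∼CC
    ... | inj₂ (inj₁ (_ , refl , x∼CD)) = suc zero , x∼CD
    ... | inj₂ (inj₂ (_ , _ , () , _))

  α[j,n+1]≡2 : ∀ j → 1 ≤ j → j ≤ n → α≡ j (suc n) 2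
  α[j,n+1]≡2 (suc j) _ j<n = reps , valid , distinct , cover
    where
    reps : Vec (SubG × SubG) 2
    reps = (C (suc j) , D n) ∷ (D j , D n) ∷ []
    valid : ∀ i → ValidPair (suc j) (suc n) (lookup reps i)
    valid zero       = CD-valid j<n ≤-refl
    valid (suc zero) = DD-valid j<n ≤-refl
    distinct : ∀ i i′ → SameOrbit (lookup reps i) (lookup reps i′) → i ≡ i′
    distinct zero       zero       _              = refl
    distinct zero       (suc zero) (g , gC≡D , _) = ⊥-elim (conj-C≢D (suc j) j g gC≡D)
    distinct (suc zero) zero       (g , gD≡C , _) = ⊥-elim (conj-D≢C j (suc j) g gD≡C)
    distinct (suc zero) (suc zero) _              = refl
    cover : ∀ x → ValidPair (suc j) (suc n) x → ∃ λ i → SameOrbit x (lookup reps i)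
    cover x v with classify v
    ... | inj₁ (n+1≤n , _)                     = ⊥-elim (n≮n n n+1≤n)
    ... | inj₂ (inj₁ (_ , refl , x∼CD))        = zero , x∼CD
    ... | inj₂ (inj₂ (_ , _ , refl , refl , x∼DD)) = suc zero , x∼DD

  α[j,k]≡3 : ∀ j k → 1 ≤ j → j < k → k ≤ n → α≡ j k 3
  α[j,k]≡3 (suc j) (suc k) _ (s≤s j<k) k<n = reps , valid , distinct , cover
    where
    reps : Vec (SubG × SubG) 3
    reps = (C (suc j) , C (suc k)) ∷ (C (suc j) , D k) ∷ (D j , D k) ∷ []
    valid : ∀ i → ValidPair (suc j) (suc k) (lookup reps i)
    valid zero             = CC-valid (s≤s j<k) k<n
    valid (suc zero)       = CD-valid j<k (<⇒≤ k<n)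
    valid (suc (suc zero)) = DD-valid j<k (<⇒≤ k<n)
    distinct : ∀ i i′ → SameOrbit (lookup reps i) (lookup reps i′) → i ≡ i′
    distinct zero             zero             _              = refl
    distinct (suc zero)       (suc zero)       _              = refl
    distinct (suc (suc zero)) (suc (suc zero)) _              = refl
    distinct zero             (suc zero)       (g , _ , gC≡D) = ⊥-elim (conj-C≢D (suc k) k g gC≡D)
    distinct (suc zero)       zero             (g , _ , gD≡C) = ⊥-elim (conj-D≢C k (suc k) g gD≡C)
    distinct zero             (suc (suc zero)) (g , gC≡D , _) = ⊥-elim (conj-C≢D (suc j) j g gC≡D)
    distinct (suc zero)       (suc (suc zero)) (g , gC≡D , _) = ⊥-elim (conj-C≢D (suc j) j g gC≡D)
    distinct (suc (suc zero)) zero             (g , gD≡C , _) = ⊥-elim (conj-D≢C j (suc j) g gD≡C)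
    distinct (suc (suc zero)) (suc zero)       (g , gD≡C , _) = ⊥-elim (conj-D≢C j (suc j) g gD≡C)
    cover : ∀ x → ValidPair (suc j) (suc k) x → ∃ λ i → SameOrbit x (lookup reps i)
    cover x v with classify v
    ... | inj₁ (_ , x∼CC)                          = zero , x∼CC
    ... | inj₂ (inj₁ (_ , refl , x∼CD))            = suc zero , x∼CD
    ... | inj₂ (inj₂ (_ , _ , refl , refl , x∼DD)) = suc (suc zero) , x∼DD

lemma4p9 : (p n : ℕ) (pp : Prime p) → ¬ (2 ∣ p) → 1 ≤ n →
    let open Dihedral p n {{prime⇒nonZero pp}} in
      α≡ 0 (suc n) 1
    × (∀ k → 1 ≤ k → k ≤ n → α≡ 0 k 2)
    × (∀ j → 1 ≤ j → j ≤ n → α≡ j (suc n) 2)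
    × (∀ j k → 1 ≤ j → j < k → k ≤ n → α≡ j k 3)
lemma4p9 p n pp ¬2∣p _ = α[0,n+1]≡1 , α[0,k]≡2 , α[j,n+1]≡2 , α[j,k]≡3
  where
  open PairClassification p n {{prime⇒nonZero pp}} (nonTrivial⇒n>1 p {{prime⇒nonTrivial pp}}) ¬2∣p
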